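{- For every integer $s\ge 1$, $\mathcal{PWG}_s\subsetneq\mathcal{PWG}_{s+1}$.
   Context: For $s\ge 1$, $\Sigma_s$ denotes the ordered alphabet $\{a_1<a_2<\dots<a_s\}$. For a nonempty word $w=w_1\cdots w_n$ over $\Sigma_s$, the Parikh graph $\mathcal{G}(w)$ is the simple undirected graph on $\{1,\dots,n\}$ where, for $i<j$, $i$ and $j$ are adjacent iff $w_i=a_k$ and $w_j=a_{k+1}$ for some $1\le k\le s-1$. $\mathcal{PWG}_s$ denotes the class of (bipartite) graphs isomorphic to $\mathcal{G}(w)$ for some nonempty word $w$ over $\Sigma_s$. -}

module Defs where

open import Level using (Level; suc; zero)
open import Data.Nat using (ℕ; _<_; _≤_; NonZero) renaming (suc to sucℕ)
open import Data.Fin using (Fin; toℕ)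
open import Data.Product using (Σ; _×_; ∃)
open import Data.Sum using (_⊎_)
open import Function.Bundles using (_↔_; Inverse)
open import Relation.Binary.PropositionalEquality using (_≡_)
open import Relation.Nullary using (¬_)

record Graph : Set₁ where
  field
    order : ℕ
    Adj   : Fin order → Fin order → Set

open Graph public

_≅_ : Graph → Graph → Set
G ≅ H = Σ (Fin (order G) ↔ Fin (order H)) λ φ →
          ∀ i j → (Adj G i j → Adj H (Inverse.to φ i) (Inverse.to φ j))
                × (Adj H (Inverse.to φ i) (Inverse.to φ j) → Adj G i j)

-- A word of length n over Σ_s = {a_1 < ... < a_s}; letter a_{k+1} is the Fin s element k.
Word : ℕ → ℕ → Set
Word s n = Fin n → Fin s

ParikhAdj : ∀ {s n} → Word s n → Fin n → Fin n → Set
ParikhAdj w i j =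
    (toℕ i < toℕ j × toℕ (w j) ≡ sucℕ (toℕ (w i)))
  ⊎ (toℕ j < toℕ i × toℕ (w i) ≡ sucℕ (toℕ (w j)))

ParikhGraph : ∀ {s n} → Word s n → Graph
ParikhGraph {s} {n} w = record { order = n ; Adj = ParikhAdj w }

PWG : ℕ → Graph → Set
PWG s G = Σ ℕ λ n → 1 ≤ n × Σ (Word s n) λ w → G ≅ ParikhGraph w

module Submission where

-- Inclusion: a word over Σ_s is also a word over Σ_(s+1), and the Parikh
-- graph only depends on the letters as natural numbers.
--
-- Strictness is witnessed by the perfect matching sK₂, measured through
-- induced matchings.
--   * Every edge of a Parikh graph is an arc u → v with u before v and
--     w_v = w_u + 1; two arcs whose tails carry the same letter force an arc
--     between the tail of one and the head of the other (cross-arc).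
--   * Over Σ_(t+1) an arc's tail carries one of the t letters a_1 … a_t, so by
--     pigeonhole an induced matching with more than t edges has two edges with
--     equal tail letters, contradicting cross-arc.  Induced matchings are
--     preserved by isomorphism, hence graphs in PWG_(t+1) have none of size t+1.
--   * The staircase word a_s a_(s-1) … a_1 a_(s+1) a_s … a_2 over Σ_(s+1)
--     has an induced matching of size s (position i paired with s+i).

open import Defs
open import Data.Nat using (ℕ; _≤_; suc)
open import Data.Product using (Σ; _×_)
open import Relation.Nullary using (¬_)

open import Data.Nat using (_+_; _<_; _<?_; z≤n; s≤s; s≤s⁻¹)
open import Data.Nat.Properties
  using (≮⇒≥; ≤-refl; 1+n≰n; ≤-<-trans; <-trans; <-≤-trans; <-irrefl; <-asym; +-cancelˡ-<; m≤m+n; ∸-monoʳ-<; suc-injective)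
import Data.Fin as Fin
open import Data.Fin using (Fin; toℕ; fromℕ<; inject₁; opposite; splitAt; _↑ˡ_; _↑ʳ_)
open import Data.Fin.Properties
  using (toℕ-inject₁; toℕ-fromℕ<; toℕ<n; toℕ-injective; toℕ-↑ˡ; toℕ-↑ʳ; splitAt-↑ˡ; splitAt-↑ʳ; opposite-prop; opposite-involutive; pigeonhole; <⇒≢)
open import Data.Product using (_,_; proj₁; proj₂)
open import Data.Sum using (_⊎_; inj₁; inj₂; [_,_]′)
open import Relation.Nullary using (yes; no)
open import Relation.Binary.PropositionalEquality
open import Function using (_∘_; id)
open import Function.Bundles using (Inverse)
open import Function.Construct.Identity using (↔-id)

Arc : ∀ {s n} → Word s n → Fin n → Fin n → Set
Arc w u v = toℕ u < toℕ v × toℕ (w v) ≡ suc (toℕ (w u))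

arc-cong : ∀ {s s′ n} {w : Word s n} {w′ : Word s′ n} →
  (∀ p → toℕ (w p) ≡ toℕ (w′ p)) → ∀ {u v} → Arc w u v → Arc w′ u v
arc-cong {w = w} {w′} same {u} {v} (u<v , ascent) = u<v , (begin
  toℕ (w′ v)       ≡⟨ sym (same v) ⟩
  toℕ (w v)        ≡⟨ ascent ⟩
  suc (toℕ (w u))  ≡⟨ cong suc (same u) ⟩
  suc (toℕ (w′ u)) ∎)
  where open ≡-Reasoning

parikh-cong : ∀ {s s′ n} {w : Word s n} {w′ : Word s′ n} →
  (∀ p → toℕ (w p) ≡ toℕ (w′ p)) → ∀ {u v} → ParikhAdj w u v → ParikhAdj w′ u v
parikh-cong same (inj₁ a) = inj₁ (arc-cong same a)
parikh-cong same (inj₂ a) = inj₂ (arc-cong same a)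

arc-ascends : ∀ {s n} (w : Word s n) {u v} → Arc w u v → toℕ (w u) < toℕ (w v)
arc-ascends w (_ , ascent) = subst (suc (toℕ (w _)) ≤_) (sym ascent) ≤-refl

cross-arc : ∀ {s n} (w : Word s n) {a b c d} → Arc w a b → Arc w c d →
  toℕ (w a) ≡ toℕ (w c) → Arc w a d ⊎ Arc w c b
cross-arc w {a} {d = d} (a<b , ab) (c<d , cd) same with toℕ a <? toℕ d
... | yes a<d = inj₁ (a<d , trans cd (cong suc (sym same)))
... | no a≮d  = inj₂ (<-trans (<-≤-trans c<d (≮⇒≥ a≮d)) a<b , trans ab (cong suc same))

pwg-mono : ∀ s (G : Graph) → PWG s G → PWG (suc s) G
pwg-mono s G (n , 1≤n , w , φ , φ-adj) =
  n , 1≤n , (inject₁ ∘ w) , φ , λ i j →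
    parikh-cong (λ p → sym (toℕ-inject₁ (w p))) ∘ proj₁ (φ-adj i j) ,
    proj₂ (φ-adj i j) ∘ parikh-cong (λ p → toℕ-inject₁ (w p))

parikh-pwg : ∀ {s n} → 1 ≤ n → (w : Word s n) → PWG s (ParikhGraph w)
parikh-pwg {n = n} 1≤n w = n , 1≤n , w , ↔-id _ , λ _ _ → id , id

OnEdge : ∀ {m V : ℕ} (left right : Fin m → Fin V) → Fin m → Fin V → Set
OnEdge left right i u = u ≡ left i ⊎ u ≡ right i

record InducedMatching (G : Graph) (m : ℕ) : Set where
  field
    left right : Fin m → Fin (order G)
    edge       : ∀ i → Adj G (left i) (right i)
    induced    : ∀ {i j u v} → i ≢ j → OnEdge left right i u → OnEdge left right j v → ¬ Adj G u v

transport-matching : ∀ {G H m} → G ≅ H → InducedMatching G m → InducedMatching H m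
transport-matching {G} {H} (φ , φ-adj) M = record
  { left    = to ∘ left
  ; right   = to ∘ right
  ; edge    = λ i → proj₁ (φ-adj (left i) (right i)) (edge i)
  ; induced = λ i≢j u∈i v∈j uv → pulled-back i≢j (preimage u∈i) (preimage v∈j) uv
  }
  where
  open InducedMatching M
  to = Inverse.to φ
  preimage : ∀ {i u} → OnEdge (to ∘ left) (to ∘ right) i u →
    Σ (Fin (order G)) λ u₀ → OnEdge left right i u₀ × u ≡ to u₀
  preimage {i} (inj₁ refl) = left i , inj₁ refl , refl
  preimage {i} (inj₂ refl) = right i , inj₂ refl , refl
  pulled-back : ∀ {i j u v} → i ≢ j →
    Σ (Fin (order G)) (λ u₀ → OnEdge left right i u₀ × u ≡ to u₀) →
    Σ (Fin (order G)) (λ v₀ → OnEdge left right j v₀ × v ≡ to v₀) → ¬ Adj H u v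
  pulled-back i≢j (u₀ , u₀∈i , refl) (v₀ , v₀∈j , refl) uv =
    induced i≢j u₀∈i v₀∈j (proj₂ (φ-adj u₀ v₀) uv)

record Oriented {s n} (w : Word s n) (u v : Fin n) : Set where
  field
    tail head : Fin n
    tail-end  : tail ≡ u ⊎ tail ≡ v
    head-end  : head ≡ u ⊎ head ≡ v
    arc       : Arc w tail head

orient : ∀ {s n} (w : Word s n) {u v} → ParikhAdj w u v → Oriented w u v
orient w {u} {v} (inj₁ a) = record { tail = u ; head = v ; tail-end = inj₁ refl ; head-end = inj₂ refl ; arc = a }
orient w {u} {v} (inj₂ a) = record { tail = v ; head = u ; tail-end = inj₂ refl ; head-end = inj₁ refl ; arc = a }

tail-letter< : ∀ {t n} (w : Word (suc t) n) {u v} → Arc w u v → toℕ (w u) < t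
tail-letter< {t} w {v = v} (_ , ascent) = s≤s⁻¹ (subst (_< suc t) ascent (toℕ<n (w v)))

-- Over Σ_(t+1) every induced matching of a Parikh graph has at most t edges:
-- with more edges, two of them have tails with equal letters (pigeonhole),
-- and cross-arc then joins an end of one to an end of the other.
parikh-matching-bound : ∀ {t n m} (w : Word (suc t) n) →
  InducedMatching (ParikhGraph w) m → m ≤ t
parikh-matching-bound {t} {m = m} w M = ≮⇒≥ too-many
  where
  open InducedMatching M
  oriented : ∀ i → Oriented w (left i) (right i)
  oriented i = orient w (edge i)
  open Oriented

  tail-letter : Fin m → Fin t
  tail-letter i = fromℕ< (tail-letter< w (arc (oriented i)))

  too-many : ¬ t < m
  too-many t<m with pigeonhole t<m tail-letter
  ... | i , j , i<j , same with cross-arc w (arc (oriented i)) (arc (oriented j)) same-letter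
    where
    same-letter : toℕ (w (tail (oriented i))) ≡ toℕ (w (tail (oriented j)))
    same-letter = begin
      toℕ (w (tail (oriented i))) ≡⟨ toℕ-fromℕ< (tail-letter< w (arc (oriented i))) ⟨
      toℕ (tail-letter i)         ≡⟨ cong toℕ same ⟩
      toℕ (tail-letter j)         ≡⟨ toℕ-fromℕ< (tail-letter< w (arc (oriented j))) ⟩
      toℕ (w (tail (oriented j))) ∎
      where open ≡-Reasoning
  ... | inj₁ i→j = induced (<⇒≢ i<j) (tail-end (oriented i)) (head-end (oriented j)) (inj₁ i→j)
  ... | inj₂ j→i = induced (≢-sym (<⇒≢ i<j)) (tail-end (oriented j)) (head-end (oriented i)) (inj₁ j→i)

pwg-matching-bound : ∀ {t m} (G : Graph) → PWG (suc t) G → InducedMatching G m → m ≤ t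
pwg-matching-bound G (_ , _ , w , G≅w) M = parikh-matching-bound w (transport-matching G≅w M)

-- The staircase word a_s a_(s-1) … a_1 a_(s+1) a_s … a_2 over Σ_(s+1):
-- position i < s carries letter index height i = s-1-i and position s+i
-- carries height i + 1, so pairing i with s+i gives an induced matching.
module Staircase (s : ℕ) where
  height : Fin s → ℕ
  height i = toℕ (opposite i)

  height-antitone : ∀ {i j} → toℕ i < toℕ j → height j < height i
  height-antitone {i} {j} i<j rewrite opposite-prop i | opposite-prop j =
    ∸-monoʳ-< (s≤s i<j) (toℕ<n j)

  height-injective : ∀ {i j} → height i ≡ height j → i ≡ j
  height-injective {i} {j} same = begin
    i                     ≡⟨ opposite-involutive i ⟨
    opposite (opposite i) ≡⟨ cong opposite (toℕ-injective same) ⟩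
    opposite (opposite j) ≡⟨ opposite-involutive j ⟩
    j                     ∎
    where open ≡-Reasoning

  word : Word (suc s) (s + s)
  word p = [ inject₁ ∘ opposite , Fin.suc ∘ opposite ]′ (splitAt s p)

  left right : Fin s → Fin (s + s)
  left i  = i ↑ˡ s
  right i = s ↑ʳ i

  letter-left : ∀ i → toℕ (word (left i)) ≡ height i
  letter-left i rewrite splitAt-↑ˡ s i s = toℕ-inject₁ (opposite i)

  letter-right : ∀ i → toℕ (word (right i)) ≡ suc (height i)
  letter-right i rewrite splitAt-↑ʳ s s i = refl

  matched-arc : ∀ i → Arc word (left i) (right i)
  matched-arc i = position< , letter-step
    where
    position< : toℕ (left i) < toℕ (right i)
    position< rewrite toℕ-↑ˡ i s | toℕ-↑ʳ s i = <-≤-trans (toℕ<n i) (m≤m+n s (toℕ i))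
    letter-step : toℕ (word (right i)) ≡ suc (toℕ (word (left i)))
    letter-step rewrite letter-right i | letter-left i = refl

  -- No arc joins ends of distinct matching edges: letters strictly decrease
  -- within each half, a first-half position i only reaches s+i, and the
  -- second half lies entirely after the first.
  no-cross-arc : ∀ {i j u v} → i ≢ j → OnEdge left right i u → OnEdge left right j v → ¬ Arc word u v
  no-cross-arc {i} {j} _ (inj₁ refl) (inj₁ refl) a =
    <-asym (height-antitone (subst₂ _<_ (toℕ-↑ˡ i s) (toℕ-↑ˡ j s) (proj₁ a)))
           (subst₂ _<_ (letter-left i) (letter-left j) (arc-ascends word a))
  no-cross-arc {i} {j} _ (inj₂ refl) (inj₂ refl) a =
    <-asym (height-antitone (+-cancelˡ-< s _ _ (subst₂ _<_ (toℕ-↑ʳ s i) (toℕ-↑ʳ s j) (proj₁ a))))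
           (s≤s⁻¹ (subst₂ _<_ (letter-right i) (letter-right j) (arc-ascends word a)))
  no-cross-arc {i} {j} i≢j (inj₁ refl) (inj₂ refl) (_ , ascent) =
    i≢j (sym (height-injective (suc-injective (subst₂ (λ a b → a ≡ suc b) (letter-right j) (letter-left i) ascent))))
  no-cross-arc {i} {j} _ (inj₂ refl) (inj₁ refl) (u<v , _) =
    <-irrefl refl (≤-<-trans (m≤m+n s (toℕ i)) (<-trans (subst₂ _<_ (toℕ-↑ʳ s i) (toℕ-↑ˡ j s) u<v) (toℕ<n j)))

  matching : InducedMatching (ParikhGraph word) s
  matching = record
    { left    = left
    ; right   = right
    ; edge    = λ i → inj₁ (matched-arc i)
    ; induced = λ where
        i≢j u∈i v∈j (inj₁ u→v) → no-cross-arc i≢j u∈i v∈j u→v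
        i≢j u∈i v∈j (inj₂ v→u) → no-cross-arc (≢-sym i≢j) v∈j u∈i v→u
    }

corollary5p8 : (s : ℕ) → 1 ≤ s →
    ((G : Graph) → PWG s G → PWG (suc s) G)
    × Σ Graph (λ G → PWG (suc s) G × ¬ PWG s G)
corollary5p8 s@(suc _) _ =
  pwg-mono s ,
  ParikhGraph word , parikh-pwg (s≤s z≤n) word ,
  λ sK₂∈PWG → 1+n≰n (pwg-matching-bound (ParikhGraph word) sK₂∈PWG matching)
  where open Staircase s
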